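{- Up to isomorphism, the disconnected graphs on $7$ vertices that are cographs and minimal $2$-polar obstructions are exactly the following five graphs: $K_1 + 3K_2$; $\;C_4 + P_3$; $\;K_1 + \big(K_1 \oplus (2K_2 + K_1)\big)$; $\;2K_1 + (K_1 \oplus C_4)$ (i.e. two isolated vertices plus the wheel $W_4$); $\;K_1 + \overline{3K_2}$.
   Context: All graphs are finite and simple; $G+H$ denotes disjoint union, $tG$ the disjoint union of $t$ copies of $G$, $G \oplus H$ the join of $G$ and $H$ (disjoint union plus all edges between them), $\overline{G}$ the complement, $P_n$ and $C_n$ the path and cycle on $n$ vertices. A cograph is a graph with no induced $P_4$. A $2$-polar partition of a graph $G$ is a partition of $V(G)$ into (possibly empty) sets $A,B$ such that $G[A]$ is a complete multipartite graph with at most $2$ parts and $G[B]$ is a disjoint union of at most $2$ cliques with no other edges; $G$ is $2$-polar if it has such a partition. A minimal $2$-polar obstruction is a graph that is not $2$-polar but all of whose proper induced subgraphs are $2$-polar. -}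

module Defs where

open import Data.Bool using (Bool; true; false; not; _∧_; _∨_)
open import Data.Nat using (ℕ; zero; suc; _+_; _*_; _∸_; _<_; _≡ᵇ_)
open import Data.Fin using (Fin; toℕ; splitAt; _≟_)
open import Data.Sum using (_⊎_; inj₁; inj₂)
open import Data.Product using (Σ; Σ-syntax; _×_; _,_)
open import Data.Empty using (⊥)
open import Relation.Nullary using (¬_)
open import Relation.Nullary.Decidable using (⌊_⌋)
open import Relation.Binary.PropositionalEquality using (_≡_; _≢_)
open import Function.Bundles using (_↔_; Inverse)
open import Function.Definitions using (Injective)

Graph : ℕ → Set
Graph n = Fin n → Fin n → Bool

IsSimple : ∀ {n} → Graph n → Set
IsSimple G = (∀ i j → G i j ≡ G j i) × (∀ i → G i i ≡ false)

Isomorphic : ∀ {n} → Graph n → Graph n → Set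
Isomorphic {n} G H =
  Σ[ φ ∈ Fin n ↔ Fin n ] (∀ i j → G (Inverse.to φ i) (Inverse.to φ j) ≡ H i j)

induce : ∀ {m n} → Graph n → (Fin m → Fin n) → Graph m
induce G f i j = G (f i) (f j)

HasInduced : ∀ {m n} → Graph n → Graph m → Set
HasInduced {m} {n} G H =
  Σ[ f ∈ (Fin m → Fin n) ] (Injective _≡_ _≡_ f × (∀ i j → G (f i) (f j) ≡ H i j))

_==_ : ∀ {n} → Fin n → Fin n → Bool
i == j = ⌊ i ≟ j ⌋

K : (n : ℕ) → Graph n
K n i j = not (i == j)

P : (n : ℕ) → Graph n
P n i j = (suc (toℕ i) ≡ᵇ toℕ j) ∨ (suc (toℕ j) ≡ᵇ toℕ i)

-- cycle C_n (intended for n ≥ 3): path plus the edge {0, n-1}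
C : (n : ℕ) → Graph n
C n i j = P n i j
        ∨ ((toℕ i ≡ᵇ 0) ∧ (toℕ j ≡ᵇ (n ∸ 1)))
        ∨ ((toℕ j ≡ᵇ 0) ∧ (toℕ i ≡ᵇ (n ∸ 1)))

_⊞_ : ∀ {m n} → Graph m → Graph n → Graph (m + n)
_⊞_ {m} G H i j with splitAt m i | splitAt m j
... | inj₁ a | inj₁ b = G a b
... | inj₂ a | inj₂ b = H a b
... | inj₁ _ | inj₂ _ = false
... | inj₂ _ | inj₁ _ = false

_⊕_ : ∀ {m n} → Graph m → Graph n → Graph (m + n)
_⊕_ {m} G H i j with splitAt m i | splitAt m j
... | inj₁ a | inj₁ b = G a b
... | inj₂ a | inj₂ b = H a b
... | inj₁ _ | inj₂ _ = true
... | inj₂ _ | inj₁ _ = true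

co : ∀ {n} → Graph n → Graph n
co G i j = not (G i j) ∧ not (i == j)

K0 : Graph 0
K0 ()

times : ∀ {n} (t : ℕ) → Graph n → Graph (t * n)
times zero G = K0
times (suc t) G = G ⊞ times t G

data Reach {n} (G : Graph n) : Fin n → Fin n → Set where
  here : ∀ {u} → Reach G u u
  step : ∀ {u v w} → G u v ≡ true → Reach G v w → Reach G u w

Connected : ∀ {n} → Graph n → Set
Connected G = ∀ u v → Reach G u v

Disconnected : ∀ {n} → Graph n → Set
Disconnected G = ¬ Connected G

Cograph : ∀ {n} → Graph n → Set
Cograph G = ¬ HasInduced G (P 4)

-- 2-polar partitions.
-- inA v = true means v ∈ A, false means v ∈ B.
-- G[A] complete multipartite with ≤ 2 parts: a 2-labelling c of A such that
--   distinct u, v ∈ A are adjacent iff they lie in different parts.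
-- G[B] disjoint union of ≤ 2 cliques: a 2-labelling d of B such that
--   distinct u, v ∈ B are adjacent iff they lie in the same clique.

record TwoPolarPartition {n} (G : Graph n) : Set where
  field
    inA : Fin n → Bool
    c   : Fin n → Bool
    d   : Fin n → Bool
    A-ok : ∀ u v → inA u ≡ true → inA v ≡ true → u ≢ v →
           (G u v ≡ true → c u ≢ c v) × (c u ≢ c v → G u v ≡ true)
    B-ok : ∀ u v → inA u ≡ false → inA v ≡ false → u ≢ v →
           (G u v ≡ true → d u ≡ d v) × (d u ≡ d v → G u v ≡ true)

TwoPolar : ∀ {n} → Graph n → Set
TwoPolar G = TwoPolarPartition G

MinimalTwoPolarObstruction : ∀ {n} → Graph n → Set
MinimalTwoPolarObstruction {n} G =
  ¬ TwoPolar G ×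
  (∀ m → m < n → (f : Fin m → Fin n) → Injective _≡_ _≡_ f → TwoPolar (induce G f))

G1 : Graph 7
G1 = K 1 ⊞ times 3 (K 2)

G2 : Graph 7
G2 = C 4 ⊞ P 3

G3 : Graph 7
G3 = K 1 ⊞ (K 1 ⊕ (times 2 (K 2) ⊞ K 1))

G4 : Graph 7
G4 = times 2 (K 1) ⊞ (K 1 ⊕ C 4)

G5 : Graph 7
G5 = K 1 ⊞ co (times 3 (K 2))

-- Both directions reduce to finite computations, checked by evaluation through Boolean
-- tests that are proved sound once, for graphs on any number of vertices:
--   * A 2-polar partition is a labelling of the vertices by side (A or B) and part or
--     clique, compatible on every pair.  A depth-first search for such labellings is
--     sound and complete, so it decides 2-polarity.  A similar sound search for induced
--     embeddings finds isomorphisms, since an injective map from Fin n to itself is onto.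
--   * Backward: each of the five graphs has a checkable certificate (a cut, no induced P4,
--     no polar labelling, a polar labelling after deleting any one vertex; deleting one
--     vertex at a time suffices for minimality), and all properties are isomorphism invariant.
--   * Forward: a disconnected simple graph has a cut (found by exploring from vertex 0).
--     By an exhaustive check over the subsets of 7 vertices, the graph can be relabelled
--     so that the sides of the cut are the first m and the last 7 - m vertices, m ≤ 3; it
--     is then a disjoint sum of two cographs.  Every simple cograph occurs, up to pointwise
--     equality, in an enumeration adding one vertex at a time, and evaluation shows that
--     each sum of enumerated cographs is 2-polar or isomorphic to one of the five graphs.

module Submission where

open import Defs
open import Data.Bool using (Bool; true; false; not; _∧_; _∨_; if_then_else_; T)
import Data.Bool as Bool
open import Data.Bool.Properties using (T-∧; T-∨; T-≡; T-not-≡)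
open import Data.Bool.ListAction using (all; any)
open import Data.Unit using (tt)
open import Data.Empty using (⊥; ⊥-elim)
open import Data.Nat using (ℕ; zero; suc; _+_; _≤_; _<_; _≡ᵇ_)
open import Data.Nat.ListAction using (sum)
open import Data.Nat.Properties using (<⇒≱; ≤-refl; ≤-trans; +-suc; +-monoʳ-≤; +-comm; <-irrefl; <-≤-trans; ≤-<-trans)
open import Data.Fin using (Fin; toℕ; #_; punchIn; punchOut; splitAt; _↑ˡ_; _↑ʳ_) renaming (zero to fzero; suc to fsuc)
import Data.Fin as Fin
open import Data.Fin.Properties
  using (↑ˡ-injective; ↑ʳ-injective; splitAt-↑ˡ; splitAt-↑ʳ; splitAt⁻¹-↑ˡ; splitAt⁻¹-↑ʳ; suc-injective;
         injective⇒≤; punchIn-punchOut; punchOut-injective; any?; all?; ¬∀⟶∃¬)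
open import Data.Fin.Subset using (Subset; ∣_∣; _∪_; ⁅_⁆; _∈_; _∉_; ∁)
open import Data.Fin.Subset.Properties
  using (∣p∣≤n; p⊂q⇒∣p∣<∣q∣; p⊆p∪q; x∈⁅x⁆; x∈⁅y⁆⇒x≡y; ∣⁅x⁆∣≡1; x∈p∪q⁻; x∈p∪q⁺; _∈?_)
open import Data.Vec using (lookup; []; _∷_)
open import Data.Vec.Properties using (lookup⇒[]=; []=⇒lookup)
open import Data.Vec.Functional using () renaming (_∷_ to _◃_)
open import Data.List using (List; []; _∷_; _++_; map; concatMap; filterᵇ; null; length; allFin)
open import Data.List.Membership.Propositional using (find; lose) renaming (_∈_ to _∈ₗ_)
open import Data.List.Membership.Propositional.Properties
  using (∈-allFin; ∈-map⁺; ∈-map⁻; ∈-concatMap⁺; ∈-concatMap⁻; ∈-filter⁺; ∈-filter⁻)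
open import Data.List.Relation.Unary.All as All using (All)
open import Data.List.Relation.Unary.All.Properties using (all⁺; all⁻)
open import Data.List.Relation.Unary.Any as Any using (Any; here; there)
open import Data.List.Relation.Unary.Any.Properties using (any⁺; any⁻)
open import Data.Product using (∃; _×_; _,_; proj₁; proj₂)
open import Data.Sum using (_⊎_; inj₁; inj₂; [_,_]′) renaming (map to ⊎-map)
open import Function using (_∘_)
open import Function.Bundles using (_↔_; _⇔_; Inverse; Equivalence; mk↔ₛ′; mk⇔)
open import Function.Properties.Inverse using (↔-trans)
open import Function.Definitions using (Injective)
open import Relation.Nullary using (¬_; Dec; yes; no; contradiction; _×-dec_; ¬?)
open import Relation.Nullary.Decidable using (T?)
open import Relation.Binary.PropositionalEquality
  using (_≡_; _≢_; refl; sym; trans; cong; cong₂; subst; subst₂)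

T-and-not : ∀ {x} → T x → T (not x) → ⊥
T-and-not {true} _ ()

∧-split : ∀ {a b} → T (a ∧ b) → T a × T b
∧-split = Equivalence.to T-∧

∨-split : ∀ {a b} → T (a ∨ b) → T a ⊎ T b
∨-split = Equivalence.to T-∨

∀ᵇ : ∀ {n} → (Fin n → Bool) → Bool
∀ᵇ {n} p = all p (allFin n)

∃ᵇ : ∀ {n} → (Fin n → Bool) → Bool
∃ᵇ {n} p = any p (allFin n)

∀ᵇ-sound : ∀ {n} (p : Fin n → Bool) → T (∀ᵇ p) → ∀ i → T (p i)
∀ᵇ-sound {n} p h i = All.lookup (all⁺ p (allFin n) h) (∈-allFin i)

∀ᵇ-complete : ∀ {n} (p : Fin n → Bool) → (∀ i → T (p i)) → T (∀ᵇ p)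
∀ᵇ-complete {n} p h = all⁻ p {allFin n} (All.tabulate λ {i} _ → h i)

∃ᵇ-sound : ∀ {n} (p : Fin n → Bool) → T (∃ᵇ p) → ∃ λ i → T (p i)
∃ᵇ-sound {n} p h = Any.satisfied (any⁻ p (allFin n) h)

∃ᵇ-complete : ∀ {n} (p : Fin n → Bool) i → T (p i) → T (∃ᵇ p)
∃ᵇ-complete {n} p i h = any⁺ p (lose (∈-allFin i) h)

sameᵇ : Bool → Bool → Bool
sameᵇ true  b = b
sameᵇ false b = not b

sameᵇ-sound : ∀ {a b} → T (sameᵇ a b) → a ≡ b
sameᵇ-sound {true}  {true}  _ = refl
sameᵇ-sound {false} {false} _ = refl

sameᵇ-complete : ∀ {a b} → a ≡ b → T (sameᵇ a b)
sameᵇ-complete {true}  refl = tt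
sameᵇ-complete {false} refl = tt

_≡ᶠ_ : ∀ {n} → Fin n → Fin n → Bool
fzero  ≡ᶠ fzero  = true
fsuc i ≡ᶠ fsuc j = i ≡ᶠ j
_      ≡ᶠ _      = false

≡ᶠ-sound : ∀ {n} {i j : Fin n} → T (i ≡ᶠ j) → i ≡ j
≡ᶠ-sound {i = fzero}  {fzero}  _ = refl
≡ᶠ-sound {i = fsuc i} {fsuc j} h = cong fsuc (≡ᶠ-sound h)

≡ᶠ-complete : ∀ {n} {i j : Fin n} → i ≡ j → T (i ≡ᶠ j)
≡ᶠ-complete {i = fzero}  refl = tt
≡ᶠ-complete {i = fsuc i} refl = ≡ᶠ-complete {i = i} refl

_≈_ : ∀ {n} → Graph n → Graph n → Set
G ≈ H = ∀ i j → G i j ≡ H i j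

≈-sym : ∀ {n} {G H : Graph n} → G ≈ H → H ≈ G
≈-sym e i j = sym (e i j)

induced-compose : ∀ {k m n} {G : Graph n} {H : Graph k} (f : Fin m → Fin n) →
                  Injective _≡_ _≡_ f → HasInduced (induce G f) H → HasInduced G H
induced-compose f f-inj (g , g-inj , eq) = f ∘ g , (λ e → g-inj (f-inj e)) , eq

induced-≈ : ∀ {m n} {G G′ : Graph n} {H : Graph m} → G ≈ G′ → HasInduced G H → HasInduced G′ H
induced-≈ e (g , g-inj , eq) = g , g-inj , λ i j → trans (sym (e (g i) (g j))) (eq i j)

cograph-induce : ∀ {m n} {G : Graph n} (f : Fin m → Fin n) → Injective _≡_ _≡_ f →
                 Cograph G → Cograph (induce G f)
cograph-induce {G = G} f f-inj cog p4 = cog (induced-compose {G = G} f f-inj p4)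

cograph-≈ : ∀ {n} {G G′ : Graph n} → G ≈ G′ → Cograph G → Cograph G′
cograph-≈ e cog p4 = cog (induced-≈ (≈-sym e) p4)

module _ where
  open TwoPolarPartition

  polar-induce : ∀ {m n} {G : Graph n} (f : Fin m → Fin n) → Injective _≡_ _≡_ f →
                 TwoPolar G → TwoPolar (induce G f)
  polar-induce f f-inj p = record
    { inA = inA p ∘ f ; c = c p ∘ f ; d = d p ∘ f
    ; A-ok = λ u v a b u≢v → A-ok p (f u) (f v) a b (u≢v ∘ f-inj)
    ; B-ok = λ u v a b u≢v → B-ok p (f u) (f v) a b (u≢v ∘ f-inj) }

  polar-≈ : ∀ {n} {G G′ : Graph n} → G ≈ G′ → TwoPolar G → TwoPolar G′
  polar-≈ e p = record
    { inA = inA p ; c = c p ; d = d p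
    ; A-ok = λ u v a b u≢v → let (⇒ , ⇐) = A-ok p u v a b u≢v
                             in (λ h → ⇒ (trans (e u v) h)) , (λ h → trans (sym (e u v)) (⇐ h))
    ; B-ok = λ u v a b u≢v → let (⇒ , ⇐) = B-ok p u v a b u≢v
                             in (λ h → ⇒ (trans (e u v) h)) , (λ h → trans (sym (e u v)) (⇐ h)) }

module _ {n} {G H : Graph n} (iso : Isomorphic G H) where
  private
    φ = proj₁ iso
    to = Inverse.to φ
    from = Inverse.from φ

  iso-to : H ≈ induce G to
  iso-to i j = sym (proj₂ iso i j)

  iso-from : G ≈ induce H from
  iso-from i j = trans (sym (cong₂ G (to∘from i) (to∘from j))) (proj₂ iso (from i) (from j))
    where to∘from = Inverse.strictlyInverseˡ φ

  to-injective : Injective _≡_ _≡_ to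
  to-injective {x} {y} e = trans (sym (from∘to x)) (trans (cong from e) (from∘to y))
    where from∘to = Inverse.strictlyInverseʳ φ

  from-injective : Injective _≡_ _≡_ from
  from-injective {x} {y} e = trans (sym (to∘from x)) (trans (cong to e) (to∘from y))
    where to∘from = Inverse.strictlyInverseˡ φ

polar-forward : ∀ {n} {G H : Graph n} → Isomorphic G H → TwoPolar G → TwoPolar H
polar-forward {G = G} {H} iso p =
  polar-≈ (≈-sym (iso-to {G = G} {H} iso)) (polar-induce {G = G} _ (to-injective {G = G} {H} iso) p)

polar-back : ∀ {n} {G H : Graph n} → Isomorphic G H → TwoPolar H → TwoPolar G
polar-back {G = G} {H} iso p =
  polar-≈ (≈-sym (iso-from {G = G} {H} iso)) (polar-induce {G = H} _ (from-injective {G = G} {H} iso) p)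

module _ {n} {G : Graph n} where
  reach-snoc : ∀ {u v w} → Reach G u v → G v w ≡ true → Reach G u w
  reach-snoc here e = step e here
  reach-snoc (step e r) e′ = step e (reach-snoc r e′)

  reach-trans : ∀ {u v w} → Reach G u v → Reach G v w → Reach G u w
  reach-trans here r = r
  reach-trans (step e q) r = step e (reach-trans q r)

  reach-sym : IsSimple G → ∀ {u v} → Reach G u v → Reach G v u
  reach-sym simple here = here
  reach-sym simple (step {u} {v} e r) = reach-snoc (reach-sym simple r) (trans (proj₁ simple v u) e)

  reach-≈ : ∀ {G′ : Graph n} → G ≈ G′ → ∀ {u v} → Reach G u v → Reach G′ u v
  reach-≈ eq here = here
  reach-≈ eq (step {u} {v} e r) = step (trans (sym (eq u v)) e) (reach-≈ eq r)

reach-relabel : ∀ {n} {G : Graph n} (f g : Fin n → Fin n) → (∀ x → f (g x) ≡ x) →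
                ∀ {u v} → Reach G u v → Reach (induce G f) (g u) (g v)
reach-relabel f g fg here = here
reach-relabel {G = G} f g fg (step {u} {w} e r) = step (trans (cong₂ G (fg u) (fg w)) e) (reach-relabel f g fg r)

connected-iso : ∀ {n} {G H : Graph n} → Isomorphic G H → Connected G → Connected H
connected-iso {G = G} {H} iso conn u v = reach-≈ (≈-sym (iso-to {G = G} {H} iso))
  (subst₂ (Reach (induce G to)) (Inverse.strictlyInverseʳ φ u) (Inverse.strictlyInverseʳ φ v)
    (reach-relabel to from (Inverse.strictlyInverseˡ φ) (conn (to u) (to v))))
  where
    φ = proj₁ iso
    to = Inverse.to φ
    from = Inverse.from φ

record Cut {n} (G : Graph n) : Set where
  field
    side     : Subset n
    inner    : Fin n
    outer    : Fin n
    inner∈   : inner ∈ side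
    outer∉   : outer ∉ side
    isolated : ∀ u v → u ∈ side → v ∉ side → G u v ≡ false

false⇒∉ : ∀ {n} {S : Subset n} {v} → lookup S v ≡ false → v ∉ S
false⇒∉ sv v∈ with () ← trans (sym ([]=⇒lookup v∈)) sv

∉⇒false : ∀ {n} {S : Subset n} {v} → v ∉ S → lookup S v ≡ false
∉⇒false {S = S} {v} v∉ with lookup S v in sv
... | true  = contradiction (lookup⇒[]= v S sv) v∉
... | false = refl

-- No path leaves the side of a cut, so a graph with a cut is disconnected.
cut⇒disconnected : ∀ {n} {G : Graph n} → Cut G → Disconnected G
cut⇒disconnected {G = G} cut conn = outer∉ (stays (conn inner outer) inner∈)
  where
    open Cut cut
    stays : ∀ {u v} → Reach G u v → u ∈ side → v ∈ side
    stays here u∈ = u∈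
    stays {u} (step {v = w} e r) u∈ with w ∈? side
    ... | yes w∈ = stays r w∈
    ... | no w∉ with () ← trans (sym e) (isolated u w u∈ w∉)

-- Growing the set of vertices reachable from vertex 0 one edge at a time either
-- exhausts all vertices or gets stuck at a cut; the size of the set bounds the number of steps.
module Explore {n} (G : Graph (suc n)) (simple : IsSimple G) where
  Reachable : Subset (suc n) → Set
  Reachable S = ∀ v → v ∈ S → Reach G fzero v

  crossing? : ∀ S → Dec (∃ λ u → ∃ λ v → u ∈ S × v ∉ S × G u v ≡ true)
  crossing? S = any? λ u → any? λ v → (u ∈? S) ×-dec ((¬? (v ∈? S)) ×-dec (G u v Bool.≟ true))

  explore : (fuel : ℕ) (S : Subset (suc n)) → fzero ∈ S → Reachable S → suc n ≤ fuel + ∣ S ∣ →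
            Connected G ⊎ Cut G
  explore fuel S 0∈S reach bound with crossing? S
  ... | yes (u , v , u∈ , v∉ , uv) = grow fuel bound
    where
      S′ = S ∪ ⁅ v ⁆
      bigger : ∣ S ∣ < ∣ S′ ∣
      bigger = p⊂q⇒∣p∣<∣q∣ (p⊆p∪q ⁅ v ⁆ , v , x∈p∪q⁺ (inj₂ (x∈⁅x⁆ v)) , v∉)
      reach′ : Reachable S′
      reach′ x x∈ with x∈p∪q⁻ S ⁅ v ⁆ x∈
      ... | inj₁ x∈S = reach x x∈S
      ... | inj₂ x∈v rewrite x∈⁅y⁆⇒x≡y v x∈v = reach-snoc (reach u u∈) uv
      grow : ∀ fuel → suc n ≤ fuel + ∣ S ∣ → Connected G ⊎ Cut G
      grow zero bound = contradiction (<-≤-trans (≤-<-trans bound bigger) (∣p∣≤n S′)) (<-irrefl refl)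
      grow (suc fuel) bound = explore fuel S′ (p⊆p∪q ⁅ v ⁆ 0∈S) reach′
        (≤-trans bound (subst (_≤ fuel + ∣ S′ ∣) (+-suc fuel ∣ S ∣) (+-monoʳ-≤ fuel bigger)))
  ... | no none with all? (_∈? S)
  ...   | yes everything = inj₁ λ u v → reach-trans (reach-sym simple (reach u (everything u))) (reach v (everything v))
  ...   | no missing = let (v , v∉) = ¬∀⟶∃¬ _ (_∈ S) (_∈? S) missing in
      inj₂ record { side = S ; inner = fzero ; outer = v ; inner∈ = 0∈S ; outer∉ = v∉ ; isolated = isolated }
    where
      isolated : ∀ u v → u ∈ S → v ∉ S → G u v ≡ false
      isolated u v u∈ v∉ with G u v in uv
      ... | true = contradiction (u , v , u∈ , v∉ , uv) none
      ... | false = refl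

connected-or-cut : ∀ {n} (G : Graph (suc n)) → IsSimple G → Connected G ⊎ Cut G
connected-or-cut {n} G simple = Explore.explore G simple n ⁅ fzero ⁆ (x∈⁅x⁆ fzero) start
  (subst (suc n ≤_) (sym (trans (cong (n +_) (∣⁅x⁆∣≡1 {n = suc n} fzero)) (+-comm n 1))) ≤-refl)
  where
    start : Explore.Reachable G simple ⁅ fzero ⁆
    start v v∈ rewrite x∈⁅y⁆⇒x≡y fzero v∈ = here

module Extension {X : Set} (candidates : List X)
                 (fits : ∀ {n} → Graph (suc n) → (Fin n → X) → X → Bool) where

  extensions : ∀ {n} → Graph (suc n) → (Fin n → X) → List (Fin (suc n) → X)
  extensions G f = map (_◃ f) (filterᵇ (fits G f) candidates)

  maps : ∀ {n} → Graph n → List (Fin n → X)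
  maps {zero} G = (λ ()) ∷ []
  maps {suc n} G = concatMap (extensions G) (maps (induce G fsuc))

  maps⁻ : ∀ {n} {G : Graph (suc n)} {g} → g ∈ₗ maps G →
          ∃ λ f → ∃ λ x → f ∈ₗ maps (induce G fsuc) × T (fits G f x) × g ≡ x ◃ f
  maps⁻ {G = G} g∈ =
    let (f , f∈ , g∈ext) = find (∈-concatMap⁻ (extensions G) g∈)
        (x , x∈ , g≡) = ∈-map⁻ (_◃ f) g∈ext
    in f , x , f∈ , proj₂ (∈-filter⁻ (T? ∘ fits G f) {xs = candidates} x∈) , g≡

  maps⁺ : ∀ {n} {G : Graph (suc n)} {f x} → f ∈ₗ maps (induce G fsuc) → x ∈ₗ candidates →
          T (fits G f x) → (x ◃ f) ∈ₗ maps G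
  maps⁺ {G = G} {f} {x} f∈ x∈ fit =
    ∈-concatMap⁺ (extensions G) (lose f∈ (∈-map⁺ (_◃ f) (∈-filter⁺ (T? ∘ fits G f) x∈ fit)))

-- A vertex lies in A (with its part) or in B (with its clique).
data Label : Set where
  A B : Bool → Label

-- The search tries B-labels first; on the graphs met here this finds labellings sooner.
labels : List Label
labels = B false ∷ B true ∷ A false ∷ A true ∷ []

compatible : Label → Label → Bool → Bool
compatible (A c) (A c′) e = sameᵇ e (not (sameᵇ c c′))
compatible (B d) (B d′) e = sameᵇ e (sameᵇ d d′)
compatible _     _      _ = true

PolarLabelling : ∀ {n} → Graph n → (Fin n → Label) → Set
PolarLabelling G lab = ∀ u v → u ≢ v → T (compatible (lab u) (lab v) (G u v))

isA : Label → Bool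
isA (A _) = true
isA (B _) = false

bit : Label → Bool
bit (A c) = c
bit (B d) = d

compatible-A : ∀ l l′ e → isA l ≡ true → isA l′ ≡ true → T (compatible l l′ e) →
               (e ≡ true → bit l ≢ bit l′) × (bit l ≢ bit l′ → e ≡ true)
compatible-A (A false) (A false) false _ _ _ = (λ ()) , λ c≢c′ → contradiction refl c≢c′
compatible-A (A false) (A true)  true  _ _ _ = (λ _ ()) , λ _ → refl
compatible-A (A true)  (A false) true  _ _ _ = (λ _ ()) , λ _ → refl
compatible-A (A true)  (A true)  false _ _ _ = (λ ()) , λ c≢c′ → contradiction refl c≢c′

compatible-B : ∀ l l′ e → isA l ≡ false → isA l′ ≡ false → T (compatible l l′ e) →
               (e ≡ true → bit l ≡ bit l′) × (bit l ≡ bit l′ → e ≡ true)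
compatible-B (B false) (B false) true  _ _ _ = (λ _ → refl) , λ _ → refl
compatible-B (B false) (B true)  false _ _ _ = (λ ()) , λ ()
compatible-B (B true)  (B false) false _ _ _ = (λ ()) , λ ()
compatible-B (B true)  (B true)  true  _ _ _ = (λ _ → refl) , λ _ → refl

labelling⇒polar : ∀ {n} {G : Graph n} {lab} → PolarLabelling G lab → TwoPolar G
labelling⇒polar {G = G} {lab} ok = record
  { inA = isA ∘ lab ; c = bit ∘ lab ; d = bit ∘ lab
  ; A-ok = λ u v a b u≢v → compatible-A (lab u) (lab v) (G u v) a b (ok u v u≢v)
  ; B-ok = λ u v a b u≢v → compatible-B (lab u) (lab v) (G u v) a b (ok u v u≢v) }

compatible-A⁺ : ∀ c c′ e → (e ≡ true → c ≢ c′) → (c ≢ c′ → e ≡ true) → T (compatible (A c) (A c′) e)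
compatible-A⁺ false false false ⇒ ⇐ = tt
compatible-A⁺ false false true  ⇒ ⇐ = ⇒ refl refl
compatible-A⁺ false true  false ⇒ ⇐ with () ← ⇐ (λ ())
compatible-A⁺ false true  true  ⇒ ⇐ = tt
compatible-A⁺ true  false false ⇒ ⇐ with () ← ⇐ (λ ())
compatible-A⁺ true  false true  ⇒ ⇐ = tt
compatible-A⁺ true  true  false ⇒ ⇐ = tt
compatible-A⁺ true  true  true  ⇒ ⇐ = ⇒ refl refl

compatible-B⁺ : ∀ d d′ e → (e ≡ true → d ≡ d′) → (d ≡ d′ → e ≡ true) → T (compatible (B d) (B d′) e)
compatible-B⁺ false false false ⇒ ⇐ with () ← ⇐ refl
compatible-B⁺ false false true  ⇒ ⇐ = tt
compatible-B⁺ false true  false ⇒ ⇐ = tt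
compatible-B⁺ false true  true  ⇒ ⇐ with () ← ⇒ refl
compatible-B⁺ true  false false ⇒ ⇐ = tt
compatible-B⁺ true  false true  ⇒ ⇐ with () ← ⇒ refl
compatible-B⁺ true  true  false ⇒ ⇐ with () ← ⇐ refl
compatible-B⁺ true  true  true  ⇒ ⇐ = tt

module _ {n} {G : Graph n} (p : TwoPolar G) where
  open TwoPolarPartition p

  partitionLabel : Fin n → Label
  partitionLabel v = if inA v then A (c v) else B (d v)

  polar⇒labelling : PolarLabelling G partitionLabel
  polar⇒labelling u v u≢v with inA u in a | inA v in b
  ... | true  | true  = let (⇒ , ⇐) = A-ok u v a b u≢v in compatible-A⁺ (c u) (c v) (G u v) ⇒ ⇐
  ... | false | false = let (⇒ , ⇐) = B-ok u v a b u≢v in compatible-B⁺ (d u) (d v) (G u v) ⇒ ⇐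
  ... | true  | false = tt
  ... | false | true  = tt

labelFits : ∀ {n} → Graph (suc n) → (Fin n → Label) → Label → Bool
labelFits G lab l = ∀ᵇ λ j → compatible l (lab j) (G fzero (fsuc j)) ∧ compatible (lab j) l (G (fsuc j) fzero)

module Labellings = Extension labels labelFits

polarLabellings : ∀ {n} → Graph n → List (Fin n → Label)
polarLabellings = Labellings.maps

polarLabellings-sound : ∀ {n} {G : Graph n} {lab} → lab ∈ₗ polarLabellings G → PolarLabelling G lab
polarLabellings-sound {zero} _ ()
polarLabellings-sound {suc n} {G} lab∈ with Labellings.maps⁻ {G = G} lab∈
... | lab′ , l , lab′∈ , fit , refl = ok
  where
    rest = polarLabellings-sound {G = induce G fsuc} lab′∈
    fit′ : ∀ j → T (compatible l (lab′ j) (G fzero (fsuc j)) ∧ compatible (lab′ j) l (G (fsuc j) fzero))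
    fit′ = ∀ᵇ-sound _ fit
    ok : PolarLabelling G (l ◃ lab′)
    ok fzero    fzero    0≢0 = contradiction refl 0≢0
    ok fzero    (fsuc j) _   = proj₁ (∧-split (fit′ j))
    ok (fsuc i) fzero    _   = proj₂ (∧-split (fit′ i))
    ok (fsuc i) (fsuc j) i≢j = rest i j (i≢j ∘ cong fsuc)

label∈labels : ∀ l → l ∈ₗ labels
label∈labels (B false) = here refl
label∈labels (B true)  = there (here refl)
label∈labels (A false) = there (there (here refl))
label∈labels (A true)  = there (there (there (here refl)))

polarLabellings-complete : ∀ {n} {G : Graph n} {lab} → PolarLabelling G lab →
                           ∃ λ lab′ → lab′ ∈ₗ polarLabellings G × (∀ v → lab′ v ≡ lab v)
polarLabellings-complete {zero} _ = (λ ()) , here refl , λ ()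
polarLabellings-complete {suc n} {G} {lab} ok
  with polarLabellings-complete {G = induce G fsuc} {lab ∘ fsuc}
         (λ i j i≢j → ok (fsuc i) (fsuc j) (i≢j ∘ suc-injective))
... | lab′ , lab′∈ , same = lab fzero ◃ lab′ , Labellings.maps⁺ {G = G} lab′∈ (label∈labels (lab fzero)) fit , agree
  where
    fit : T (labelFits G lab′ (lab fzero))
    fit = ∀ᵇ-complete _ λ j → Equivalence.from T-∧
      ( subst (λ l → T (compatible (lab fzero) l (G fzero (fsuc j)))) (sym (same j)) (ok fzero (fsuc j) (λ ()))
      , subst (λ l → T (compatible l (lab fzero) (G (fsuc j) fzero))) (sym (same j)) (ok (fsuc j) fzero (λ ())))
    agree : ∀ v → (lab fzero ◃ lab′) v ≡ lab v
    agree fzero    = refl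
    agree (fsuc v) = same v

polarᵇ : ∀ {n} → Graph n → Bool
polarᵇ G = not (null (polarLabellings G))

found : ∀ {X : Set} (xs : List X) → T (not (null xs)) → ∃ λ x → x ∈ₗ xs
found (x ∷ _) _ = x , here refl

nonempty-null : ∀ {X : Set} {x : X} {xs} → x ∈ₗ xs → T (null xs) → ⊥
nonempty-null (here _) ()
nonempty-null (there _) ()

polarᵇ-sound : ∀ {n} (G : Graph n) → T (polarᵇ G) → TwoPolar G
polarᵇ-sound G h = let (lab , lab∈) = found (polarLabellings G) h
                   in labelling⇒polar {G = G} {lab} (polarLabellings-sound {G = G} lab∈)

notPolarᵇ-sound : ∀ {n} (G : Graph n) → T (null (polarLabellings G)) → ¬ TwoPolar G
notPolarᵇ-sound G none p =
  let (_ , lab∈ , _) = polarLabellings-complete {G = G} {partitionLabel p} (polar⇒labelling p) in nonempty-null lab∈ none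

missed-vertex : ∀ {m n} → m < n → (f : Fin m → Fin n) → ∃ λ v → ∀ i → f i ≢ v
missed-vertex {m} {n} m<n f with all? (λ v → any? (λ i → f i Fin.≟ v))
... | yes hit = contradiction (injective⇒≤ preimage-injective) (<⇒≱ m<n)
  where
    preimage-injective : Injective _≡_ _≡_ (λ v → proj₁ (hit v))
    preimage-injective {x} {y} e = trans (sym (proj₂ (hit x))) (trans (cong f e) (proj₂ (hit y)))
... | no ¬hit = let (v , miss) = ¬∀⟶∃¬ n _ (λ v → any? (λ i → f i Fin.≟ v)) ¬hit in v , λ i e → miss (i , e)

-- If deleting any single vertex leaves a 2-polar graph, every proper induced subgraph is
-- 2-polar: it avoids some vertex v, hence is an induced subgraph of G minus v.
deletions⇒proper-polar : ∀ {n} {G : Graph (suc n)} → (∀ v → TwoPolar (induce G (punchIn v))) →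
                         ∀ m → m < suc n → (f : Fin m → Fin (suc n)) → Injective _≡_ _≡_ f →
                         TwoPolar (induce G f)
deletions⇒proper-polar {n} {G} deleted m m<n f f-inj with missed-vertex m<n f
... | v , miss = polar-≈ same (polar-induce g g-injective (deleted v))
  where
    g : Fin m → Fin n
    g i = punchOut (miss i ∘ sym)
    g-injective : Injective _≡_ _≡_ g
    g-injective {i} {j} e = f-inj (punchOut-injective {i = v} (miss i ∘ sym) (miss j ∘ sym) e)
    same : induce (induce G (punchIn v)) g ≈ induce G f
    same i j = cong₂ G (punchIn-punchOut _) (punchIn-punchOut _)

embedFits : ∀ {n} → Graph n → ∀ {m} → Graph (suc m) → (Fin m → Fin n) → Fin n → Bool
embedFits G H f w =
  sameᵇ (G w w) (H fzero fzero) ∧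
  ∀ᵇ λ j → not (f j ≡ᶠ w) ∧ sameᵇ (G w (f j)) (H fzero (fsuc j)) ∧ sameᵇ (G (f j) w) (H (fsuc j) fzero)

module Embeddings {n} (G : Graph n) = Extension (allFin n) (embedFits G)

embeddings : ∀ {m n} → Graph n → Graph m → List (Fin m → Fin n)
embeddings G = Embeddings.maps G

embeddings-sound : ∀ {m n} (G : Graph n) {H : Graph m} {f} → f ∈ₗ embeddings G H →
                   Injective _≡_ _≡_ f × (∀ i j → G (f i) (f j) ≡ H i j)
embeddings-sound {zero} G _ = (λ {}) , λ ()
embeddings-sound {suc m} G {H} f∈ with Embeddings.maps⁻ G {G = H} f∈
... | f₀ , w , f₀∈ , fit , refl = injective , adjacent
  where
    rest = embeddings-sound G {H = induce H fsuc} f₀∈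
    loop = ∧-split fit
    fit′ : ∀ j → T (not (f₀ j ≡ᶠ w)) × T (sameᵇ (G w (f₀ j)) (H fzero (fsuc j))) × T (sameᵇ (G (f₀ j) w) (H (fsuc j) fzero))
    fit′ j = let (new , rest′) = ∧-split (∀ᵇ-sound _ (proj₂ loop) j) in new , ∧-split rest′
    w-new : ∀ j → f₀ j ≢ w
    w-new j e = T-and-not (≡ᶠ-complete e) (proj₁ (fit′ j))
    injective : Injective _≡_ _≡_ (w ◃ f₀)
    injective {fzero}  {fzero}  _ = refl
    injective {fzero}  {fsuc j} e = ⊥-elim (w-new j (sym e))
    injective {fsuc i} {fzero}  e = ⊥-elim (w-new i e)
    injective {fsuc i} {fsuc j} e = cong fsuc (proj₁ rest e)
    adjacent : ∀ i j → G ((w ◃ f₀) i) ((w ◃ f₀) j) ≡ H i j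
    adjacent fzero    fzero    = sameᵇ-sound (proj₁ loop)
    adjacent fzero    (fsuc j) = sameᵇ-sound (proj₁ (proj₂ (fit′ j)))
    adjacent (fsuc i) fzero    = sameᵇ-sound (proj₂ (proj₂ (fit′ i)))
    adjacent (fsuc i) (fsuc j) = proj₂ rest i j

injective⇒surjective : ∀ {n} (f : Fin n → Fin n) → Injective _≡_ _≡_ f → ∀ y → ∃ λ x → f x ≡ y
injective⇒surjective {suc k} f f-inj y with any? (λ x → f x Fin.≟ y)
... | yes hit = hit
... | no miss = contradiction (injective⇒≤ g-injective) (<-irrefl refl)
  where
    g : Fin (suc k) → Fin k
    g x = punchOut {i = y} λ e → miss (x , sym e)
    g-injective : Injective _≡_ _≡_ g
    g-injective {a} {b} e = f-inj (punchOut-injective {i = y} (λ e′ → miss (a , sym e′)) (λ e′ → miss (b , sym e′)) e)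

injective⇒↔ : ∀ {n} (f : Fin n → Fin n) → Injective _≡_ _≡_ f → Fin n ↔ Fin n
injective⇒↔ f f-inj = mk↔ₛ′ f (proj₁ ∘ onto) (proj₂ ∘ onto) (λ x → f-inj (proj₂ (onto (f x))))
  where onto = injective⇒surjective f f-inj

embedding⇒iso : ∀ {n} {G H : Graph n} {f} → Injective _≡_ _≡_ f → (∀ i j → G (f i) (f j) ≡ H i j) →
                Isomorphic G H
embedding⇒iso {f = f} f-inj adj = injective⇒↔ f f-inj , adj

iso-trans : ∀ {n} {G H K : Graph n} → Isomorphic G H → Isomorphic H K → Isomorphic G K
iso-trans {G = G} (φ , φ-adj) (ψ , ψ-adj) =
  ↔-trans ψ φ , λ i j → trans (φ-adj (Inverse.to ψ i) (Inverse.to ψ j)) (ψ-adj i j)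

isoᵇ : ∀ {n} → Graph n → Graph n → Bool
isoᵇ G H = not (null (embeddings G H))

isoᵇ-sound : ∀ {n} (G H : Graph n) → T (isoᵇ G H) → Isomorphic G H
isoᵇ-sound G H h = let (f , f∈) = found (embeddings G H) h
                       (f-inj , adj) = embeddings-sound G {H = H} f∈
                   in embedding⇒iso {G = G} {H} f-inj adj

p4Pattern : ∀ {n} → Graph n → Fin n → Fin n → Fin n → Fin n → Bool
p4Pattern G a b c d = G a b ∧ G b c ∧ G c d ∧ not (G a c) ∧ not (G a d) ∧ not (G b d)

cographᵇ : ∀ {n} → Graph n → Bool
cographᵇ G = ∀ᵇ λ a → ∀ᵇ λ b → ∀ᵇ λ c → ∀ᵇ λ d → not (p4Pattern G a b c d)

cographᵇ-sound : ∀ {n} (G : Graph n) → T (cographᵇ G) → Cograph G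
cographᵇ-sound G h (f , _ , adj) =
  excluded (adj (# 0) (# 1)) (adj (# 1) (# 2)) (adj (# 2) (# 3)) (adj (# 0) (# 2)) (adj (# 0) (# 3)) (adj (# 1) (# 3))
    (∀ᵇ-sound _ (∀ᵇ-sound _ (∀ᵇ-sound _ (∀ᵇ-sound _ h (f (# 0))) (f (# 1))) (f (# 2))) (f (# 3)))
  where
    excluded : ∀ {x₁ x₂ x₃ x₄ x₅ x₆} → x₁ ≡ true → x₂ ≡ true → x₃ ≡ true → x₄ ≡ false → x₅ ≡ false → x₆ ≡ false →
               T (not (x₁ ∧ x₂ ∧ x₃ ∧ not x₄ ∧ not x₅ ∧ not x₆)) → ⊥
    excluded refl refl refl refl refl refl ()

twinFreeᵇ : ∀ {n} → Graph n → Bool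
twinFreeᵇ H = ∀ᵇ λ i → ∀ᵇ λ j → (i ≡ᶠ j) ∨ ∃ᵇ (λ k → not (sameᵇ (H i k) (H j k)))

twinFree-injective : ∀ {m n} {G : Graph n} {H : Graph m} {f : Fin m → Fin n} → T (twinFreeᵇ H) →
                     (∀ i j → G (f i) (f j) ≡ H i j) → Injective _≡_ _≡_ f
twinFree-injective {G = G} {H} {f} twinFree adj {i} {j} fi≡fj
  with ∨-split (∀ᵇ-sound _ (∀ᵇ-sound _ twinFree i) j)
... | inj₁ i≡j = ≡ᶠ-sound i≡j
... | inj₂ differ with ∃ᵇ-sound _ differ
...   | k , Hik≢Hjk = ⊥-elim (T-and-not (sameᵇ-complete same) Hik≢Hjk)
  where
    same : H i k ≡ H j k
    same = trans (sym (adj i k)) (trans (cong (λ x → G x (f k)) fi≡fj) (adj j k))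

p4-facts : ∀ {x₁ x₂ x₃ x₄ x₅ x₆} → T (x₁ ∧ x₂ ∧ x₃ ∧ not x₄ ∧ not x₅ ∧ not x₆) →
           x₁ ≡ true × x₂ ≡ true × x₃ ≡ true × x₄ ≡ false × x₅ ≡ false × x₆ ≡ false
p4-facts {true} {true} {true} {false} {false} {false} _ = refl , refl , refl , refl , refl , refl

p4-from : ∀ {n} {G : Graph n} → IsSimple G → ∀ a b c d → T (p4Pattern G a b c d) → HasInduced G (P 4)
p4-from {G = G} (symmetric , loopless) a b c d path =
  f , twinFree-injective {G = G} {P 4} tt adj , adj
  where
    f : Fin 4 → Fin _
    f = a ◃ b ◃ c ◃ d ◃ λ ()
    facts = p4-facts {G a b} {G b c} {G c d} {G a c} {G a d} {G b d} path
    ab = proj₁ facts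
    bc = proj₁ (proj₂ facts)
    cd = proj₁ (proj₂ (proj₂ facts))
    ac = proj₁ (proj₂ (proj₂ (proj₂ facts)))
    ad = proj₁ (proj₂ (proj₂ (proj₂ (proj₂ facts))))
    bd = proj₂ (proj₂ (proj₂ (proj₂ (proj₂ facts))))
    flipped : ∀ {x y b} → G x y ≡ b → G y x ≡ b
    flipped {x} {y} e = trans (symmetric y x) e
    adj : ∀ i j → G (f i) (f j) ≡ P 4 i j
    adj fzero fzero = loopless a
    adj fzero (fsuc fzero) = ab
    adj fzero (fsuc (fsuc fzero)) = ac
    adj fzero (fsuc (fsuc (fsuc fzero))) = ad
    adj (fsuc fzero) fzero = flipped ab
    adj (fsuc fzero) (fsuc fzero) = loopless b
    adj (fsuc fzero) (fsuc (fsuc fzero)) = bc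
    adj (fsuc fzero) (fsuc (fsuc (fsuc fzero))) = bd
    adj (fsuc (fsuc fzero)) fzero = flipped ac
    adj (fsuc (fsuc fzero)) (fsuc fzero) = flipped bc
    adj (fsuc (fsuc fzero)) (fsuc (fsuc fzero)) = loopless c
    adj (fsuc (fsuc fzero)) (fsuc (fsuc (fsuc fzero))) = cd
    adj (fsuc (fsuc (fsuc fzero))) fzero = flipped ad
    adj (fsuc (fsuc (fsuc fzero))) (fsuc fzero) = flipped bd
    adj (fsuc (fsuc (fsuc fzero))) (fsuc (fsuc fzero)) = flipped cd
    adj (fsuc (fsuc (fsuc fzero))) (fsuc (fsuc (fsuc fzero))) = loopless d

extend : ∀ {k} → (Fin k → Bool) → Graph k → Graph (suc k)
extend r G fzero    fzero    = false
extend r G fzero    (fsuc j) = r j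
extend r G (fsuc i) fzero    = r i
extend r G (fsuc i) (fsuc j) = G i j

neighbourhoods : ∀ k → List (Fin k → Bool)
neighbourhoods zero    = (λ ()) ∷ []
neighbourhoods (suc k) = concatMap (λ r → (false ◃ r) ∷ (true ◃ r) ∷ []) (neighbourhoods k)

neighbourhoods-complete : ∀ {k} (r : Fin k → Bool) → ∃ λ r′ → r′ ∈ₗ neighbourhoods k × (∀ i → r′ i ≡ r i)
neighbourhoods-complete {zero} r = (λ ()) , here refl , λ ()
neighbourhoods-complete {suc k} r with neighbourhoods-complete (r ∘ fsuc)
... | r′ , r′∈ , same = r fzero ◃ r′ , ∈-concatMap⁺ _ (lose r′∈ (first (r fzero))) , agree
  where
    first : ∀ b → (b ◃ r′) ∈ₗ (false ◃ r′) ∷ (true ◃ r′) ∷ []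
    first false = here refl
    first true  = there (here refl)
    agree : ∀ i → (r fzero ◃ r′) i ≡ r i
    agree fzero    = refl
    agree (fsuc i) = same i

-- Whether vertex 0 lies on an induced P4, as an end (0–a–b–c) or inner vertex (a–0–b–c);
-- by symmetry of the path these are all cases.
p4At0 : ∀ {k} → Graph (suc k) → Fin k → Fin k → Fin k → Bool
p4At0 G a b c = p4Pattern G fzero (fsuc a) (fsuc b) (fsuc c) ∨ p4Pattern G (fsuc a) fzero (fsuc b) (fsuc c)

p4Through0ᵇ : ∀ {k} → Graph (suc k) → Bool
p4Through0ᵇ G = ∃ᵇ λ a → ∃ᵇ λ b → ∃ᵇ λ c → p4At0 G a b c

p4Pattern-≈ : ∀ {n} {G G′ : Graph n} → G ≈ G′ → ∀ a b c d → p4Pattern G a b c d ≡ p4Pattern G′ a b c d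
p4Pattern-≈ e a b c d rewrite e a b | e b c | e c d | e a c | e a d | e b d = refl

p4Through0ᵇ-sound : ∀ {k} {G G′ : Graph (suc k)} → IsSimple G′ → G ≈ G′ → T (p4Through0ᵇ G) → HasInduced G′ (P 4)
p4Through0ᵇ-sound {G = G} {G′} simple e h =
  let (a , h₁) = ∃ᵇ-sound (λ a → ∃ᵇ λ b → ∃ᵇ λ c → p4At0 G a b c) h
      (b , h₂) = ∃ᵇ-sound (λ b → ∃ᵇ λ c → p4At0 G a b c) h₁
      (c , h₃) = ∃ᵇ-sound (p4At0 G a b) h₂
  in [ (λ end   → p4-from simple _ _ _ _ (subst T (p4Pattern-≈ e fzero (fsuc a) (fsuc b) (fsuc c)) end))
     , (λ inner → p4-from simple _ _ _ _ (subst T (p4Pattern-≈ e (fsuc a) fzero (fsuc b) (fsuc c)) inner))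
     ]′ (∨-split h₃)

cographs : ∀ k → List (Graph k)
cographs zero    = K0 ∷ []
cographs (suc k) = concatMap (λ G → filterᵇ (not ∘ p4Through0ᵇ) (map (λ r → extend r G) (neighbourhoods k))) (cographs k)

cographs-complete : ∀ {k} {G : Graph k} → IsSimple G → Cograph G → ∃ λ G′ → G′ ∈ₗ cographs k × G′ ≈ G
cographs-complete {zero} _ _ = K0 , here refl , λ ()
cographs-complete {suc k} {G} simple@(symmetric , loopless) cog
  with cographs-complete {G = induce G fsuc} ((λ i j → symmetric _ _) , (λ i → loopless _))
                         (cograph-induce {G = G} fsuc suc-injective cog)
     | neighbourhoods-complete (λ j → G fzero (fsuc j))
... | G₀ , G₀∈ , G₀≈ | r , r∈ , r≡ = extend r G₀ , member , same
  where
    same : extend r G₀ ≈ G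
    same fzero    fzero    = sym (loopless fzero)
    same fzero    (fsuc j) = r≡ j
    same (fsuc i) fzero    = trans (r≡ i) (symmetric fzero (fsuc i))
    same (fsuc i) (fsuc j) = G₀≈ i j
    no-p4 : T (not (p4Through0ᵇ (extend r G₀)))
    no-p4 with p4Through0ᵇ (extend r G₀) in found
    ... | false = tt
    ... | true  = cog (p4Through0ᵇ-sound simple same (subst T (sym found) tt))
    member : extend r G₀ ∈ₗ cographs (suc k)
    member = ∈-concatMap⁺ _ (lose G₀∈ (∈-filter⁺ (T? ∘ (not ∘ p4Through0ᵇ)) (∈-map⁺ (λ r → extend r G₀) r∈) no-p4))

⊞-≈ : ∀ {m n} {A A′ : Graph m} {B B′ : Graph n} → A ≈ A′ → B ≈ B′ → (A ⊞ B) ≈ (A′ ⊞ B′)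
⊞-≈ {m} eA eB i j with splitAt m i | splitAt m j
... | inj₁ a | inj₁ b = eA a b
... | inj₁ _ | inj₂ _ = refl
... | inj₂ _ | inj₁ _ = refl
... | inj₂ a | inj₂ b = eB a b

split-sum : ∀ {m n} (H : Graph (m + n)) →
            (∀ a b → H (a ↑ˡ n) (m ↑ʳ b) ≡ false) → (∀ a b → H (m ↑ʳ b) (a ↑ˡ n) ≡ false) →
            (induce H (_↑ˡ n) ⊞ induce H (m ↑ʳ_)) ≈ H
split-sum {m} {n} H left right i j with splitAt m i in ei | splitAt m j in ej
... | inj₁ a | inj₁ b = cong₂ H (splitAt⁻¹-↑ˡ ei) (splitAt⁻¹-↑ˡ ej)
... | inj₁ a | inj₂ b = trans (sym (left a b)) (cong₂ H (splitAt⁻¹-↑ˡ ei) (splitAt⁻¹-↑ʳ ej))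
... | inj₂ a | inj₁ b = trans (sym (right b a)) (cong₂ H (splitAt⁻¹-↑ʳ ei) (splitAt⁻¹-↑ˡ ej))
... | inj₂ a | inj₂ b = cong₂ H (splitAt⁻¹-↑ʳ ei) (splitAt⁻¹-↑ʳ ej)

cographSumsᵇ : ∀ m n → (Graph (m + n) → Bool) → Bool
cographSumsᵇ m n P = all (λ A → all (λ B → P (A ⊞ B)) (cographs n)) (cographs m)

cographSums-sound : ∀ {m n} (P : Graph (m + n) → Bool) → cographSumsᵇ m n P ≡ true →
                    ∀ {A B} → IsSimple A → Cograph A → IsSimple B → Cograph B →
                    ∃ λ L → T (P L) × L ≈ (A ⊞ B)
cographSums-sound {m} {n} P h simpleA cogA simpleB cogB =
  let (A′ , A′∈ , A′≈) = cographs-complete simpleA cogA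
      (B′ , B′∈ , B′≈) = cographs-complete simpleB cogB
      forB = All.lookup (all⁺ _ (cographs m) (Equivalence.from T-≡ h)) A′∈
  in A′ ⊞ B′ , All.lookup (all⁺ _ (cographs n) forB) B′∈ , ⊞-≈ A′≈ B′≈

blocks : ∀ m n → Graph (m + n)
blocks m n = _⊞_ {m} {n} (λ _ _ → true) (λ _ _ → true)

blocks-apart : ∀ m n (a : Fin m) (b : Fin n) → blocks m n (a ↑ˡ n) (m ↑ʳ b) ≡ false × blocks m n (m ↑ʳ b) (a ↑ˡ n) ≡ false
blocks-apart m n a b rewrite splitAt-↑ˡ m a n | splitAt-↑ʳ m n b = refl , refl

sameSide : ∀ {n} → Subset n → Graph n
sameSide S u v = sameᵇ (lookup S u) (lookup S v)

cut-separates : ∀ {n} {G : Graph n} → IsSimple G → (cut : Cut G) → ∀ u v →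
                sameSide (Cut.side cut) u v ≡ false → G u v ≡ false
cut-separates (symmetric , _) cut u v apart with lookup (Cut.side cut) u in su | lookup (Cut.side cut) v in sv
... | true  | false = Cut.isolated cut u v (lookup⇒[]= u _ su) (false⇒∉ sv)
... | false | true  = trans (symmetric u v) (Cut.isolated cut v u (lookup⇒[]= v _ sv) (false⇒∉ su))

injectiveᵇ : ∀ {m n} → (Fin m → Fin n) → Bool
injectiveᵇ f = ∀ᵇ λ i → ∀ᵇ λ j → (i ≡ᶠ j) ∨ not (f i ≡ᶠ f j)

injectiveᵇ-sound : ∀ {m n} (f : Fin m → Fin n) → T (injectiveᵇ f) → Injective _≡_ _≡_ f
injectiveᵇ-sound f h {i} {j} fi≡fj with ∨-split (∀ᵇ-sound _ (∀ᵇ-sound _ h i) j)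
... | inj₁ i≡j  = ≡ᶠ-sound i≡j
... | inj₂ fi≢fj = ⊥-elim (T-and-not (≡ᶠ-complete fi≡fj) fi≢fj)

realisesᵇ : ∀ {m n} → Graph n → Graph m → (Fin m → Fin n) → Bool
realisesᵇ G H f = ∀ᵇ λ i → ∀ᵇ λ j → sameᵇ (G (f i) (f j)) (H i j)

realisesᵇ-sound : ∀ {m n} (G : Graph n) (H : Graph m) f → T (realisesᵇ G H f) → ∀ i j → G (f i) (f j) ≡ H i j
realisesᵇ-sound G H f h i j = sameᵇ-sound (∀ᵇ-sound _ (∀ᵇ-sound _ h i) j)

-- f relabels the vertices of a graph with cut side S so that the two sides become the blocks m and n.
arrangedAsᵇ : ∀ m n {N} → Subset N → (Fin (m + n) → Fin N) → Bool
arrangedAsᵇ m n S f = injectiveᵇ f ∧ realisesᵇ (sameSide S) (blocks m n) f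

-- Relabelled in this way, a simple cograph G is (up to ≈) a sum of two enumerated
-- cographs, so every property tested on all such sums holds for it.
arranged-sum : ∀ {m n N} {G : Graph N} → IsSimple G → Cograph G → (cut : Cut G) →
               ∀ {f : Fin (m + n) → Fin N} → T (arrangedAsᵇ m n (Cut.side cut) f) →
               (P : Graph (m + n) → Bool) → cographSumsᵇ m n P ≡ true →
               ∃ λ L → T (P L) × L ≈ induce G f
arranged-sum {m} {n} {G = G} simple@(symmetric , loopless) cog cut {f} arranged P h =
  let (L , PL , L≈) = cographSums-sound P h (simple-part (_↑ˡ n)) (cograph-part (_↑ˡ n) (↑ˡ-injective n _ _))
                                            (simple-part (m ↑ʳ_)) (cograph-part (m ↑ʳ_) (↑ʳ-injective m _ _))
  in L , PL , λ i j → trans (L≈ i j) (split-sum H left right i j)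
  where
    H = induce G f
    f-inj = injectiveᵇ-sound f (proj₁ (∧-split arranged))
    sides = realisesᵇ-sound (sameSide (Cut.side cut)) (blocks m n) f (proj₂ (∧-split arranged))
    simple-part : ∀ {k} (g : Fin k → Fin (m + n)) → IsSimple (induce H g)
    simple-part g = (λ i j → symmetric _ _) , (λ i → loopless _)
    cograph-part : ∀ {k} (g : Fin k → Fin (m + n)) → Injective _≡_ _≡_ g → Cograph (induce H g)
    cograph-part g g-inj = cograph-induce {G = H} g g-inj (cograph-induce {G = G} f f-inj cog)
    left : ∀ a b → H (a ↑ˡ n) (m ↑ʳ b) ≡ false
    left a b = cut-separates simple cut _ _ (trans (sides _ _) (proj₁ (blocks-apart m n a b)))
    right : ∀ a b → H (m ↑ʳ b) (a ↑ˡ n) ≡ false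
    right a b = cut-separates simple cut _ _ (trans (sides _ _) (proj₂ (blocks-apart m n a b)))

∀subsetᵇ : ∀ n → (Subset n → Bool) → Bool
∀subsetᵇ zero    p = p []
∀subsetᵇ (suc n) p = ∀subsetᵇ n (p ∘ (false ∷_)) ∧ ∀subsetᵇ n (p ∘ (true ∷_))

∀subsetᵇ-sound : ∀ n (p : Subset n → Bool) → ∀subsetᵇ n p ≡ true → ∀ S → T (p S)
∀subsetᵇ-sound n p h = sound n p (Equivalence.from T-≡ h)
  where
    sound : ∀ n (p : Subset n → Bool) → T (∀subsetᵇ n p) → ∀ S → T (p S)
    sound zero    p h []          = h
    sound (suc n) p h (false ∷ S) = sound n _ (proj₁ (∧-split h)) S
    sound (suc n) p h (true ∷ S)  = sound n _ (proj₂ (∧-split h)) S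

properSidesᵇ : ∀ {n} → (Subset n → Bool) → (Subset n → Bool) → Subset n → Bool
properSidesᵇ q₁ q₂ S = not (∃ᵇ (lookup S)) ∨ ∀ᵇ (lookup S) ∨ q₁ S ∨ q₂ S

cut-sides : ∀ {n} {G : Graph n} (q₁ q₂ : Subset n → Bool) → ∀subsetᵇ n (properSidesᵇ q₁ q₂) ≡ true →
            (cut : Cut G) → T (q₁ (Cut.side cut)) ⊎ T (q₂ (Cut.side cut))
cut-sides {n} q₁ q₂ h cut = sides (∨-split (∀subsetᵇ-sound n _ h S))
  where
    S = Cut.side cut
    nonempty : T (∃ᵇ (lookup S))
    nonempty = ∃ᵇ-complete (lookup S) (Cut.inner cut) (Equivalence.from T-≡ ([]=⇒lookup (Cut.inner∈ cut)))
    sides : T (not (∃ᵇ (lookup S))) ⊎ T (∀ᵇ (lookup S) ∨ q₁ S ∨ q₂ S) → T (q₁ S) ⊎ T (q₂ S)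
    sides (inj₁ empty) = ⊥-elim (T-and-not nonempty empty)
    sides (inj₂ rest) with ∨-split rest
    ... | inj₁ full = ⊥-elim (Cut.outer∉ cut (lookup⇒[]= _ S (Equivalence.to T-≡ (∀ᵇ-sound _ full (Cut.outer cut)))))
    ... | inj₂ q    = ∨-split q

cutᵇ : ∀ {n} → Graph n → Subset n → Bool
cutᵇ G S = ∃ᵇ (lookup S) ∧ ∃ᵇ (not ∘ lookup S) ∧ ∀ᵇ λ u → ∀ᵇ λ v → not (lookup S u ∧ not (lookup S v) ∧ G u v)

cutᵇ-sound : ∀ {n} (G : Graph n) (S : Subset n) → T (cutᵇ G S) → Cut G
cutᵇ-sound G S h = record
  { side = S ; inner = inner ; outer = outer
  ; inner∈ = lookup⇒[]= inner S (Equivalence.to T-≡ inner∈)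
  ; outer∉ = false⇒∉ (Equivalence.to T-not-≡ outer∉)
  ; isolated = isolated }
  where
    parts = ∧-split h
    parts′ = ∧-split (proj₂ parts)
    someInside = ∃ᵇ-sound (lookup S) (proj₁ parts)
    someOutside = ∃ᵇ-sound (not ∘ lookup S) (proj₁ parts′)
    inner = proj₁ someInside
    inner∈ = proj₂ someInside
    outer = proj₁ someOutside
    outer∉ = proj₂ someOutside
    isolated : ∀ u v → u ∈ S → v ∉ S → G u v ≡ false
    isolated u v u∈ v∉ = no-edge ([]=⇒lookup u∈) (∉⇒false v∉) (∀ᵇ-sound _ (∀ᵇ-sound _ (proj₂ parts′) u) v)
      where
        no-edge : ∀ {a b e} → a ≡ true → b ≡ false → T (not (a ∧ not b ∧ e)) → e ≡ false
        no-edge {e = false} refl refl _ = refl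

Obstruction : ∀ {n} → Graph n → Set
Obstruction G = Disconnected G × Cograph G × MinimalTwoPolarObstruction G

obstruction-iso : ∀ {n} {G H : Graph n} → Isomorphic G H → Obstruction H → Obstruction G
obstruction-iso {G = G} {H} iso (disconnected , cograph , nonpolar , proper) =
  disconnected ∘ connected-iso iso ,
  cograph-≈ (≈-sym (iso-from {G = G} {H} iso)) (cograph-induce {G = H} from (from-injective {G = G} {H} iso) cograph) ,
  nonpolar ∘ polar-forward iso ,
  λ m m<n f f-inj → polar-≈ (λ i j → sym (iso-from {G = G} {H} iso (f i) (f j)))
                      (proper m m<n (from ∘ f) (λ e → f-inj (from-injective {G = G} {H} iso e)))
  where from = Inverse.from (proj₁ iso)

obstructionᵇ : ∀ {n} → Graph (suc n) → Subset (suc n) → Bool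
obstructionᵇ G S = cutᵇ G S ∧ cographᵇ G ∧ null (polarLabellings G) ∧ ∀ᵇ (λ v → polarᵇ (induce G (punchIn v)))

obstructionᵇ-sound : ∀ {n} (G : Graph (suc n)) (S : Subset (suc n)) → obstructionᵇ G S ≡ true → Obstruction G
obstructionᵇ-sound G S h =
  let (cut , rest) = ∧-split (Equivalence.from T-≡ h)
      (cograph , rest′) = ∧-split rest
      (nonpolar , deletions) = ∧-split rest′
  in cut⇒disconnected (cutᵇ-sound G S cut) , cographᵇ-sound G cograph , notPolarᵇ-sound G nonpolar ,
     deletions⇒proper-polar {G = G} (λ v → polarᵇ-sound _ (∀ᵇ-sound _ deletions v))

-- The number of ordered adjacent pairs, an isomorphism invariant.
edgeCount : ∀ {n} → Graph n → ℕ
edgeCount {n} G = sum (map (λ i → length (filterᵇ (G i) (allFin n))) (allFin n))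

OneOfFive : Graph 7 → Set
OneOfFive G = Isomorphic G G1 ⊎ Isomorphic G G2 ⊎ Isomorphic G G3 ⊎ Isomorphic G G4 ⊎ Isomorphic G G5

isoToᵇ : Graph 7 → Graph 7 → Bool
isoToᵇ L H = (edgeCount L ≡ᵇ edgeCount H) ∧ isoᵇ L H

classifiedᵇ : Graph 7 → Bool
classifiedᵇ L = polarᵇ L ∨ isoToᵇ L G1 ∨ isoToᵇ L G2 ∨ isoToᵇ L G3 ∨ isoToᵇ L G4 ∨ isoToᵇ L G5

isoToᵇ-sound : ∀ L H → T (isoToᵇ L H) → Isomorphic L H
isoToᵇ-sound L H = isoᵇ-sound L H ∘ proj₂ ∘ ∧-split

classifiedᵇ-sound : ∀ L → T (classifiedᵇ L) → ¬ TwoPolar L → OneOfFive L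
classifiedᵇ-sound L h nonpolar with ∨-split h
... | inj₁ polar = ⊥-elim (nonpolar (polarᵇ-sound L polar))
... | inj₂ h₁ with ∨-split h₁
... | inj₁ i₁ = inj₁ (isoToᵇ-sound L G1 i₁)
... | inj₂ h₂ with ∨-split h₂
... | inj₁ i₂ = inj₂ (inj₁ (isoToᵇ-sound L G2 i₂))
... | inj₂ h₃ with ∨-split h₃
... | inj₁ i₃ = inj₂ (inj₂ (inj₁ (isoToᵇ-sound L G3 i₃)))
... | inj₂ h₄ with ∨-split h₄
... | inj₁ i₄ = inj₂ (inj₂ (inj₂ (inj₁ (isoToᵇ-sound L G4 i₄))))
... | inj₂ i₅ = inj₂ (inj₂ (inj₂ (inj₂ (isoToᵇ-sound L G5 i₅))))

oneOfFive-iso : ∀ {G L} → Isomorphic G L → OneOfFive L → OneOfFive G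
oneOfFive-iso {G} {L} iso = ⊎-map via (⊎-map via (⊎-map via (⊎-map via via)))
  where
    via : ∀ {H} → Isomorphic L H → Isomorphic G H
    via = iso-trans {G = G} {L} iso

listing : Subset 7 → Fin 7 → Fin 7
listing S i = nth (filterᵇ (lookup S) (allFin 7) ++ filterᵇ (not ∘ lookup S) (allFin 7)) (toℕ i)
  where
    nth : List (Fin 7) → ℕ → Fin 7
    nth []       _       = fzero
    nth (x ∷ xs) zero    = x
    nth (x ∷ xs) (suc k) = nth xs k

arrangementsᵇ : Subset 7 → (Fin 7 → Fin 7) → Bool
arrangementsᵇ S σ = arrangedAsᵇ 1 6 S σ ∨ arrangedAsᵇ 2 5 S σ ∨ arrangedAsᵇ 3 4 S σ

-- For every nonempty proper subset S of the 7 vertices, listing S first or its complement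
-- first (whichever has at most 3 elements) gives an arrangement.
cuts-arrangeable : ∀subsetᵇ 7 (properSidesᵇ (λ S → arrangementsᵇ S (listing S)) (λ S → arrangementsᵇ S (listing (∁ S)))) ≡ true
cuts-arrangeable = refl

sums-classified₁₊₆ : cographSumsᵇ 1 6 classifiedᵇ ≡ true
sums-classified₁₊₆ = refl

sums-classified₂₊₅ : cographSumsᵇ 2 5 classifiedᵇ ≡ true
sums-classified₂₊₅ = refl

sums-classified₃₊₄ : cographSumsᵇ 3 4 classifiedᵇ ≡ true
sums-classified₃₊₄ = refl

classify : ∀ G → IsSimple G → Disconnected G → Cograph G → ¬ TwoPolar G → OneOfFive G
classify G simple disconnected cograph nonpolar with connected-or-cut G simple
... | inj₁ connected = ⊥-elim (disconnected connected)
... | inj₂ cut = [ arranged (listing S) , arranged (listing (∁ S)) ]′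
                   (cut-sides (λ S → arrangementsᵇ S (listing S)) (λ S → arrangementsᵇ S (listing (∁ S))) cuts-arrangeable cut)
  where
    S = Cut.side cut
    conclude : ∀ {σ} → T (injectiveᵇ σ) → (∃ λ L → T (classifiedᵇ L) × L ≈ induce G σ) → OneOfFive G
    conclude {σ} inj (L , classified , L≈) =
      oneOfFive-iso {G} {L} iso (classifiedᵇ-sound L classified (nonpolar ∘ polar-back {G = G} {L} iso))
      where iso = embedding⇒iso {G = G} {L} (injectiveᵇ-sound σ inj) (λ i j → sym (L≈ i j))
    arranged : ∀ σ → T (arrangementsᵇ S σ) → OneOfFive G
    arranged σ h with ∨-split h
    ... | inj₁ a = conclude (proj₁ (∧-split a)) (arranged-sum {1} {6} simple cograph cut {σ} a classifiedᵇ sums-classified₁₊₆)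
    ... | inj₂ h′ with ∨-split h′
    ...   | inj₁ a = conclude (proj₁ (∧-split a)) (arranged-sum {2} {5} simple cograph cut {σ} a classifiedᵇ sums-classified₂₊₅)
    ...   | inj₂ a = conclude (proj₁ (∧-split a)) (arranged-sum {3} {4} simple cograph cut {σ} a classifiedᵇ sums-classified₃₊₄)

-- Backward direction: the five graphs carry certificates, checked by evaluation, with cut
-- side {0} (an isolated vertex) or, for C4 + P3, the C4 on {0, 1, 2, 3}.
vertex0 firstFour : Subset 7
vertex0   = true ∷ false ∷ false ∷ false ∷ false ∷ false ∷ false ∷ []
firstFour = true ∷ true ∷ true ∷ true ∷ false ∷ false ∷ false ∷ []

obstructions : ∀ {G} → OneOfFive G → Obstruction G
obstructions {G} =
  [ (λ iso → obstruction-iso {G = G} iso (obstructionᵇ-sound G1 vertex0 refl)) ,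
  [ (λ iso → obstruction-iso {G = G} iso (obstructionᵇ-sound G2 firstFour refl)) ,
  [ (λ iso → obstruction-iso {G = G} iso (obstructionᵇ-sound G3 vertex0 refl)) ,
  [ (λ iso → obstruction-iso {G = G} iso (obstructionᵇ-sound G4 vertex0 refl)) ,
    (λ iso → obstruction-iso {G = G} iso (obstructionᵇ-sound G5 vertex0 refl)) ]′ ]′ ]′ ]′

mainTheorem6 : (G : Graph 7) → IsSimple G →
    ((Disconnected G × Cograph G × MinimalTwoPolarObstruction G) ⇔
     (Isomorphic G G1 ⊎ Isomorphic G G2 ⊎ Isomorphic G G3 ⊎ Isomorphic G G4 ⊎ Isomorphic G G5))
mainTheorem6 G simple = mk⇔
  (λ (disconnected , cograph , nonpolar , _) → classify G simple disconnected cograph nonpolar)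
  obstructions
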